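{- Let $M$ be a positroid on $[n]$ without coloops. For every nonempty subset $A\subseteq[n]$ there exists $x\in A$ such that $\operatorname{cw}_M(A\setminus\{x\})\geq\operatorname{cw}_M(A)-1$.
   Context: For $i\in[n]$ the cyclic order $<_i$ is $i<_i i+1<_i\cdots<_i n<_i 1<_i\cdots<_i i-1$. A decorated permutation on $[n]$ is $(\pi,\operatorname{col})$, $\pi$ a permutation of $[n]$, $\operatorname{col}:[n]\to\{0,1,-1\}$ with $\operatorname{col}(i)=0$ iff $\pi(i)\neq i$; each positroid $M$ on $[n]$ corresponds to a unique decorated permutation (its bases are the sets $B$ with $I_i\le_i B$ in Gale order for all $i$, where $I_i=\{j: j<_i\pi^{ -1}(j)\text{ or }\operatorname{col}(j)=-1\}$), and coloops of $M$ are the $i$ with $\pi(i)=i$, $\operatorname{col}(i)=-1$. The CW-arrow starting at $i$ is $C_i=[n]$ if $\pi(i)=i$ and $\operatorname{col}(i)=-1$, and otherwise $C_i=\{j: j\leq_i\pi(i)\}$. The CW-function of $M$ (without coloops) is $\operatorname{cw}_M(A)=|\{i\in[n]: C_i\subseteq A\}|$ for $A\neq[n]$, and $\operatorname{cw}_M([n])=n-\operatorname{rk}_M([n])$. -}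

module Defs where

open import Data.Nat using (ℕ; _+_; _∸_; _≤_; _<_; _≤?_; _<?_)
open import Data.Fin using (Fin; toℕ)
open import Data.Fin.Subset using (Subset; ⊤; ∣_∣; _⊆_)
open import Data.Fin.Subset.Properties using (_⊆?_)
open import Data.Fin.Permutation using (Permutation′; _⟨$⟩ʳ_; _⟨$⟩ˡ_)
open import Data.Bool using (Bool; true; false; _∨_; if_then_else_)
open import Data.Bool.Properties using () renaming (_≟_ to _≟B_)
open import Data.Vec using (tabulate)
open import Data.Vec.Properties using (≡-dec)
open import Data.Product using (_×_)
open import Relation.Nullary using (¬_; does)
open import Relation.Binary.PropositionalEquality using (_≡_; _≢_)

-- The ground set [n] is modelled as Fin n, with element k ∈ [n]
-- represented by the Fin element of value k-1.

data Colour : Set where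
  c0 c+1 c-1 : Colour

record DecoratedPermutation (n : ℕ) : Set where
  field
    perm      : Permutation′ n
    col       : Fin n → Colour
    col-zero⇒ : ∀ i → col i ≡ c0 → (perm ⟨$⟩ʳ i) ≢ i
    ⇒col-zero : ∀ i → (perm ⟨$⟩ʳ i) ≢ i → col i ≡ c0

open DecoratedPermutation public

module _ {n : ℕ} where

  -- position of j in the cyclic order starting at base point b
  -- (b is the 0-based value of the starting element)
  offset : ℕ → Fin n → ℕ
  offset b j = if does (b ≤? toℕ j) then toℕ j ∸ b else (toℕ j + n) ∸ b

  cyc≤ : Fin n → Fin n → Fin n → Bool
  cyc≤ i j k = does (offset (toℕ i) j ≤? offset (toℕ i) k)

  isNeg : Colour → Bool
  isNeg c-1 = true
  isNeg c0  = false
  isNeg c+1 = false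

  -- Grassmann-necklace set I_b = { j : j <_b π⁻¹(j) or col(j) = -1 }
  -- for the cyclic order starting at the element with 0-based value b.
  Iset : DecoratedPermutation n → ℕ → Subset n
  Iset D b = tabulate λ j →
    does (offset b j <? offset b (perm D ⟨$⟩ˡ j)) ∨ isNeg (col D j)

  IsColoop : DecoratedPermutation n → Fin n → Set
  IsColoop D i = (perm D ⟨$⟩ʳ i ≡ i) × (col D i ≡ c-1)

  NoColoops : DecoratedPermutation n → Set
  NoColoops D = ∀ i → ¬ IsColoop D i

  -- rk_M([n]): every basis B satisfies I_1 ≤ B in Gale order, which
  -- compares sets of equal size, so every basis has |I_1| elements.
  rankM : DecoratedPermutation n → ℕ
  rankM D = ∣ Iset D 0 ∣

  cwArrow : DecoratedPermutation n → Fin n → Subset n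
  cwArrow D i with perm D ⟨$⟩ʳ i Data.Fin.≟ i | col D i
  ... | Relation.Nullary.yes _ | c-1 = ⊤
  ... | _ | _ = tabulate λ j → cyc≤ i j (perm D ⟨$⟩ʳ i)

  cw : DecoratedPermutation n → Subset n → ℕ
  cw D A = if does (≡-dec _≟B_ A ⊤)
           then n ∸ rankM D
           else ∣ tabulate (λ i → does (cwArrow D i ⊆? A)) ∣

-- For A ≠ [n], pick y ∉ A and let i₀ be the first element after y (in the
-- cyclic order <_y) whose arrow lies in A.  Without coloops every arrow C_i is
-- the cyclic interval from i to π(i), and one lying in A avoids y; so if C_i ⊆ A
-- contains i₀, then i comes no later than i₀ after y, and minimality forces
-- i = i₀.  Removing i₀ ∈ C_{i₀} ⊆ A thus destroys at most one arrow.
-- For A = [n], n − rk = |[n] ∖ I_1| is at most #{j : π⁻¹(j) ≤ j}, which after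
-- reindexing by π is the number of non-wrapping arrows i ≤ π(i); all of them
-- except C_1 avoid 1, so they lie in [n] ∖ {1}.
module Submission where

open import Defs
open import Data.Nat using (ℕ; _+_; _≤_)
open import Data.Fin.Subset using (Subset; Nonempty; _∈_; _-_)
open import Data.Product using (∃; _×_; _,_)

open import Level using (Level)
open import Function using (_∘_; case_of_)
open import Data.Nat using (zero; suc; _<_; _∸_; _≤?_; _<?_; z≤n; s≤s)
open import Data.Nat.Properties hiding (_≟_)
open import Data.Fin using (Fin; zero; suc; toℕ)
open import Data.Fin.Properties using (_≟_; toℕ<n; toℕ-injective; any?; ¬∀⟶∃¬)
open import Data.Fin.Subset using (_∉_; ⊤; ∁; ∣_∣; _⊆_; _∪_; ⁅_⁆; inside; outside)
open import Data.Fin.Subset.Properties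
  using (_⊆?_; _∈?_; ∈⊤; ⊆⊤; ⊆-antisym; x∈⁅x⁆; ∣⁅x⁆∣≡1; ∣p∣≤n; ∣p∣≤∣x∷p∣; ∣⊤∣≡n;
         p⊆q⇒∣p∣≤∣q∣; ∣∁p∣≡n∸∣p∣; x∈∁p⇒x∉p; x∈p∪q⁺; x∈p∧x≢y⇒x∈p-y; x∈p⇒∣p-x∣<∣p∣)
open import Data.Fin.Permutation using (Permutation′; _⟨$⟩ʳ_; _⟨$⟩ˡ_; inverseˡ)
open import Data.Vec using (tabulate; []; _∷_)
open import Data.Vec.Properties using (≡-dec; []=⇒lookup; lookup⇒[]=; lookup∘tabulate)
open import Data.Bool using (Bool; true; false; _∨_; if_then_else_)
open import Data.Bool.Properties using () renaming (_≟_ to _≟B_)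
open import Data.List using (filter; allFin)
open import Data.List.Relation.Unary.All as All using ()
open import Data.List.Relation.Unary.All.Properties using (all-filter)
open import Data.List.Membership.Propositional.Properties using (∈-filter⁺; ∈-allFin)
open import Data.List.Extrema.Nat using (argmin; argmin-all; f[argmin]≤f[xs])
open import Data.Sum using (inj₁; inj₂)
open import Relation.Nullary using (Dec; yes; no; does; contradiction)
open import Relation.Nullary.Decidable using (dec-true; dec-false)
open import Relation.Unary using (Pred; Decidable)
open import Relation.Binary.PropositionalEquality
open import Algebra.Properties.CommutativeMonoid.Sum +-0-commutativeMonoid using (sum; sum-permute)

private
  variable
    ℓ : Level
    n : ℕ

∈-tabulate⁺ : {f : Fin n → Bool} {i : Fin n} → f i ≡ true → i ∈ tabulate f
∈-tabulate⁺ {f = f} {i} fi = lookup⇒[]= i _ (trans (lookup∘tabulate f i) fi)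

∈-tabulate⁻ : {f : Fin n → Bool} {i : Fin n} → i ∈ tabulate f → f i ≡ true
∈-tabulate⁻ {f = f} {i} i∈ = trans (sym (lookup∘tabulate f i)) ([]=⇒lookup i∈)

module _ {P : Pred (Fin n) ℓ} (P? : Decidable P) where

  ∈-tabulate-does⁺ : ∀ {i} → P i → i ∈ tabulate (does ∘ P?)
  ∈-tabulate-does⁺ {i} Pi = ∈-tabulate⁺ (dec-true (P? i) Pi)

  ∈-tabulate-does⁻ : ∀ {i} → i ∈ tabulate (does ∘ P?) → P i
  ∈-tabulate-does⁻ {i} i∈ with P? i | ∈-tabulate⁻ {f = does ∘ P?} i∈
  ... | yes Pi | _  = Pi
  ... | no _   | ()

  argmin-exists : (f : Fin n → ℕ) → ∃ P → ∃ λ i → P i × (∀ {j} → P j → f i ≤ f j)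
  argmin-exists f (i , Pi) =
    argmin f i xs ,
    argmin-all f Pi (all-filter P? (allFin n)) ,
    λ {j} Pj → All.lookup (f[argmin]≤f[xs] i xs) (∈-filter⁺ P? (∈-allFin j) Pj)
    where xs = filter P? (allFin n)

∣p∪q∣≤∣p∣+∣q∣ : (p q : Subset n) → ∣ p ∪ q ∣ ≤ ∣ p ∣ + ∣ q ∣
∣p∪q∣≤∣p∣+∣q∣ []            []            = z≤n
∣p∪q∣≤∣p∣+∣q∣ (inside  ∷ p) (y       ∷ q) =
  s≤s (≤-trans (∣p∪q∣≤∣p∣+∣q∣ p q) (+-monoʳ-≤ ∣ p ∣ (∣p∣≤∣x∷p∣ y q)))
∣p∪q∣≤∣p∣+∣q∣ (outside ∷ p) (inside  ∷ q) =
  ≤-trans (s≤s (∣p∪q∣≤∣p∣+∣q∣ p q)) (≤-reflexive (sym (+-suc ∣ p ∣ ∣ q ∣)))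
∣p∪q∣≤∣p∣+∣q∣ (outside ∷ p) (outside ∷ q) = ∣p∪q∣≤∣p∣+∣q∣ p q

∣p∣≤∣q∣+1 : {p q : Subset n} (x : Fin n) → (∀ {i} → i ∈ p → i ≢ x → i ∈ q) → ∣ p ∣ ≤ ∣ q ∣ + 1
∣p∣≤∣q∣+1 {n} {p} {q} x p-x⊆q = begin
  ∣ p ∣           ≤⟨ p⊆q⇒∣p∣≤∣q∣ p⊆q∪⁅x⁆ ⟩
  ∣ q ∪ ⁅ x ⁆ ∣   ≤⟨ ∣p∪q∣≤∣p∣+∣q∣ q ⁅ x ⁆ ⟩
  ∣ q ∣ + ∣ ⁅ x ⁆ ∣ ≡⟨ cong (∣ q ∣ +_) (∣⁅x⁆∣≡1 x) ⟩
  ∣ q ∣ + 1       ∎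
  where
  open ≤-Reasoning
  p⊆q∪⁅x⁆ : p ⊆ q ∪ ⁅ x ⁆
  p⊆q∪⁅x⁆ {i} i∈p with i ≟ x
  ... | yes refl = x∈p∪q⁺ (inj₂ (x∈⁅x⁆ x))
  ... | no  i≢x  = x∈p∪q⁺ (inj₁ (p-x⊆q i∈p i≢x))

p-x≢⊤ : {p : Subset n} {x : Fin n} → x ∈ p → p - x ≢ ⊤
p-x≢⊤ {n} {p} {x} x∈p p-x≡⊤ = <⇒≱ (x∈p⇒∣p-x∣<∣p∣ x∈p) (begin
  ∣ p ∣     ≤⟨ ∣p∣≤n p ⟩
  n         ≡⟨ sym (∣⊤∣≡n n) ⟩
  ∣ ⊤ {n} ∣ ≡⟨ cong ∣_∣ (sym p-x≡⊤) ⟩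
  ∣ p - x ∣ ∎)
  where open ≤-Reasoning

≢⊤⇒∃∉ : {p : Subset n} → p ≢ ⊤ → ∃ λ y → y ∉ p
≢⊤⇒∃∉ {n} {p} p≢⊤ = ¬∀⟶∃¬ n (_∈ p) (_∈? p) λ ∀∈p → p≢⊤ (⊆-antisym ⊆⊤ λ {y} _ → ∀∈p y)

∣tabulate∣≡sum : (f : Fin n → Bool) → ∣ tabulate f ∣ ≡ sum (λ i → if f i then 1 else 0)
∣tabulate∣≡sum {zero}  f = refl
∣tabulate∣≡sum {suc n} f with f zero
... | true  = cong suc (∣tabulate∣≡sum (f ∘ suc))
... | false = ∣tabulate∣≡sum (f ∘ suc)

∣tabulate∣-permute : (f : Fin n → Bool) (ρ : Permutation′ n) →
  ∣ tabulate f ∣ ≡ ∣ tabulate (f ∘ (ρ ⟨$⟩ʳ_)) ∣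
∣tabulate∣-permute f ρ = begin
  ∣ tabulate f ∣                              ≡⟨ ∣tabulate∣≡sum f ⟩
  sum (λ i → if f i then 1 else 0)             ≡⟨ sum-permute _ ρ ⟩
  sum (λ i → if f (ρ ⟨$⟩ʳ i) then 1 else 0)    ≡⟨ sym (∣tabulate∣≡sum (f ∘ (ρ ⟨$⟩ʳ_))) ⟩
  ∣ tabulate (f ∘ (ρ ⟨$⟩ʳ_)) ∣                ∎
  where open ≡-Reasoning

≤-unshift : ∀ {a b c A B} → a + c ≡ A → b + c ≡ B → A ≤ B → a ≤ b
≤-unshift {a} {b} {c} refl refl = +-cancelʳ-≤ c a b

<-unshift : ∀ {a b c A B} → a + c ≡ A → b + c ≡ B → A < B → a < b
<-unshift {a} {b} {c} refl refl = +-cancelʳ-< c a b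

<-shift : ∀ {a b c A B} → a + c ≡ A → b + c ≡ B → a < b → A < B
<-shift {c = c} refl refl = +-monoˡ-< c

dist : Fin n → Fin n → ℕ
dist i = offset (toℕ i)

dist-≤ : {i k : Fin n} → toℕ i ≤ toℕ k → dist i k + toℕ i ≡ toℕ k
dist-≤ {i = i} {k} i≤k rewrite dec-true (toℕ i ≤? toℕ k) i≤k = m∸n+n≡m i≤k

dist-> : {i k : Fin n} → toℕ k < toℕ i → dist i k + toℕ i ≡ toℕ k + n
dist-> {n} {i} {k} k<i rewrite dec-false (toℕ i ≤? toℕ k) (<⇒≱ k<i) =
  m∸n+n≡m (≤-trans (<⇒≤ (toℕ<n i)) (m≤n+m n (toℕ k)))

dist-self : (i : Fin n) → dist i i ≡ 0
dist-self i = +-cancelʳ-≡ (toℕ i) _ 0 (dist-≤ ≤-refl)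

dist-unwrapped≢wrapped : {y i j : Fin n} → toℕ y ≤ toℕ i → toℕ j < toℕ y → dist y i ≢ dist y j
dist-unwrapped≢wrapped {n} {y} {i} {j} y≤i j<y eq = <⇒≱ (toℕ<n i) (begin
  n                 ≤⟨ m≤n+m n (toℕ j) ⟩
  toℕ j + n         ≡⟨ sym (dist-> j<y) ⟩
  dist y j + toℕ y  ≡⟨ cong (_+ toℕ y) (sym eq) ⟩
  dist y i + toℕ y  ≡⟨ dist-≤ y≤i ⟩
  toℕ i             ∎)
  where open ≤-Reasoning

dist-injective : (y : Fin n) {i j : Fin n} → dist y i ≡ dist y j → i ≡ j
dist-injective {n} y {i} {j} eq with toℕ y ≤? toℕ i | toℕ y ≤? toℕ j
... | yes y≤i | yes y≤j = toℕ-injective (begin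
  toℕ i              ≡⟨ sym (dist-≤ y≤i) ⟩
  dist y i + toℕ y   ≡⟨ cong (_+ toℕ y) eq ⟩
  dist y j + toℕ y   ≡⟨ dist-≤ y≤j ⟩
  toℕ j              ∎)
  where open ≡-Reasoning
... | no y≰i | no y≰j = toℕ-injective (+-cancelʳ-≡ n (toℕ i) (toℕ j) (begin
  toℕ i + n          ≡⟨ sym (dist-> (≰⇒> y≰i)) ⟩
  dist y i + toℕ y   ≡⟨ cong (_+ toℕ y) eq ⟩
  dist y j + toℕ y   ≡⟨ dist-> (≰⇒> y≰j) ⟩
  toℕ j + n          ∎))
  where open ≡-Reasoning
... | yes y≤i | no y≰j = contradiction eq (dist-unwrapped≢wrapped y≤i (≰⇒> y≰j))
... | no y≰i | yes y≤j = contradiction (sym eq) (dist-unwrapped≢wrapped y≤j (≰⇒> y≰i))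

dist-rotate : {j i y : Fin n} → dist j i < dist j y → dist y j ≤ dist y i
dist-rotate {n} {j} {i} {y} ji<jy with toℕ j ≤? toℕ i | toℕ j ≤? toℕ y
... | yes j≤i | yes j≤y =
  let i<y = <-shift (dist-≤ j≤i) (dist-≤ j≤y) ji<jy
  in ≤-unshift (dist-> (≤-<-trans j≤i i<y)) (dist-> i<y) (+-monoˡ-≤ n j≤i)
... | yes j≤i | no j≰y =
  let y<j = ≰⇒> j≰y
  in ≤-unshift (dist-≤ (<⇒≤ y<j)) (dist-≤ (≤-trans (<⇒≤ y<j) j≤i)) j≤i
... | no j≰i | yes j≤y =
  contradiction (<-shift (dist-> (≰⇒> j≰i)) (dist-≤ j≤y) ji<jy)
                (≤⇒≯ (≤-trans (<⇒≤ (toℕ<n y)) (m≤n+m n (toℕ i))))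
... | no j≰i | no j≰y =
  let i<y = +-cancelʳ-< n (toℕ i) (toℕ y) (<-shift (dist-> (≰⇒> j≰i)) (dist-> (≰⇒> j≰y)) ji<jy)
  in ≤-unshift (dist-≤ (<⇒≤ (≰⇒> j≰y))) (dist-> i<y) (≤-trans (<⇒≤ (toℕ<n j)) (m≤n+m n (toℕ i)))

dist-wrap : {i j k : Fin n} → toℕ k < toℕ i → toℕ i ≤ toℕ j → dist i j < dist i k
dist-wrap {n} {i} {j} {k} k<i i≤j =
  <-unshift (dist-≤ i≤j) (dist-> k<i) (<-≤-trans (toℕ<n j) (m≤n+m n (toℕ k)))

module _ {n : ℕ} (D : DecoratedPermutation n) where

  private
    π : Fin n → Fin n
    π i = perm D ⟨$⟩ʳ i

  arrowsWithin : Subset n → Subset n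
  arrowsWithin A = tabulate (λ i → does (cwArrow D i ⊆? A))

  cw-⊤ : cw D ⊤ ≡ n ∸ rankM D
  cw-⊤ = cong (λ b → if b then n ∸ rankM D else ∣ arrowsWithin ⊤ ∣)
              (dec-true (≡-dec _≟B_ (⊤ {n}) ⊤) refl)

  cw-≢⊤ : {A : Subset n} → A ≢ ⊤ → cw D A ≡ ∣ arrowsWithin A ∣
  cw-≢⊤ {A} A≢⊤ = cong (λ b → if b then n ∸ rankM D else ∣ arrowsWithin A ∣)
                       (dec-false (≡-dec _≟B_ A ⊤) A≢⊤)

  cw≤cw-x+1 : {A : Subset n} {x : Fin n} → A ≢ ⊤ → x ∈ A →
    (∀ {i} → i ∈ arrowsWithin A → i ≢ x → i ∈ arrowsWithin (A - x)) →
    cw D A ≤ cw D (A - x) + 1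
  cw≤cw-x+1 A≢⊤ x∈A keep rewrite cw-≢⊤ A≢⊤ | cw-≢⊤ (p-x≢⊤ x∈A) = ∣p∣≤∣q∣+1 _ keep

  module _ (noColoops : NoColoops D) where

    cwArrow-interval : (i : Fin n) → cwArrow D i ≡ tabulate (λ j → cyc≤ i j (π i))
    cwArrow-interval i with π i ≟ i | col D i in colᵢ
    ... | yes πi≡i | c-1 = contradiction (πi≡i , colᵢ) (noColoops i)
    ... | yes _    | c0  = refl
    ... | yes _    | c+1 = refl
    ... | no _     | _   = refl

    ∈cwArrow⁺ : {i k : Fin n} → dist i k ≤ dist i (π i) → k ∈ cwArrow D i
    ∈cwArrow⁺ {i} k≤πi = subst (_ ∈_) (sym (cwArrow-interval i))
      (∈-tabulate-does⁺ (λ j → dist i j ≤? dist i (π i)) k≤πi)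

    ∈cwArrow⁻ : {i k : Fin n} → k ∈ cwArrow D i → dist i k ≤ dist i (π i)
    ∈cwArrow⁻ {i} k∈ = ∈-tabulate-does⁻ (λ j → dist i j ≤? dist i (π i))
      (subst (_ ∈_) (cwArrow-interval i) k∈)

    ∈cwArrow-self : (i : Fin n) → i ∈ cwArrow D i
    ∈cwArrow-self i = ∈cwArrow⁺ (subst (_≤ dist i (π i)) (sym (dist-self i)) z≤n)

    cwArrow-avoids-before : {i k : Fin n} → toℕ k < toℕ i → toℕ i ≤ toℕ (π i) → k ∉ cwArrow D i
    cwArrow-avoids-before k<i i≤πi k∈ = <⇒≱ (dist-wrap k<i i≤πi) (∈cwArrow⁻ k∈)

    first-arrow-unique : {A : Subset n} {y i₀ i : Fin n} → y ∉ A →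
      (∀ {j} → cwArrow D j ⊆ A → dist y i₀ ≤ dist y j) →
      cwArrow D i ⊆ A → i₀ ∈ cwArrow D i → i ≡ i₀
    first-arrow-unique {y = y} {i₀} {i} y∉A minimal Cᵢ⊆A i₀∈Cᵢ =
      dist-injective y (≤-antisym (dist-rotate {j = i} (≤-<-trans (∈cwArrow⁻ i₀∈Cᵢ) πi<y))
                                  (minimal {i} Cᵢ⊆A))
      where
      πi<y : dist i (π i) < dist i y
      πi<y = ≰⇒> (λ y≤πi → y∉A (Cᵢ⊆A (∈cwArrow⁺ y≤πi)))

    cw-drop-first-arrow : {A : Subset n} → A ≢ ⊤ → Nonempty A →
      ∃ λ x → x ∈ A × cw D A ≤ cw D (A - x) + 1
    cw-drop-first-arrow {A} A≢⊤ (x₀ , x₀∈A) with ≢⊤⇒∃∉ A≢⊤ | any? (λ i → cwArrow D i ⊆? A)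
    ... | _ | no ∄arrow = x₀ , x₀∈A , cw≤cw-x+1 A≢⊤ x₀∈A λ {i} i∈ _ →
      contradiction (i , λ {_} → ∈-tabulate-does⁻ (λ j → cwArrow D j ⊆? A) i∈) ∄arrow
    ... | y , y∉A | yes ∃arrow with argmin-exists (λ i → cwArrow D i ⊆? A) (dist y) ∃arrow
    ...   | i₀ , Cᵢ₀⊆A , minimal = i₀ , i₀∈A , cw≤cw-x+1 A≢⊤ i₀∈A keep
      where
      i₀∈A : i₀ ∈ A
      i₀∈A = Cᵢ₀⊆A (∈cwArrow-self i₀)
      keep : ∀ {i} → i ∈ arrowsWithin A → i ≢ i₀ → i ∈ arrowsWithin (A - i₀)
      keep {i} i∈ i≢i₀ = ∈-tabulate-does⁺ (λ j → cwArrow D j ⊆? (A - i₀)) λ k∈Cᵢ →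
        x∈p∧x≢y⇒x∈p-y (Cᵢ⊆A k∈Cᵢ) λ { refl → i≢i₀ (first-arrow-unique y∉A minimal Cᵢ⊆A k∈Cᵢ) }
        where
        Cᵢ⊆A : cwArrow D i ⊆ A
        Cᵢ⊆A = ∈-tabulate-does⁻ (λ j → cwArrow D j ⊆? A) i∈

module _ {m : ℕ} (D : DecoratedPermutation (suc m)) (noColoops : NoColoops D) where

  private
    π : Fin (suc m) → Fin (suc m)
    π i = perm D ⟨$⟩ʳ i

    backward? : (j : Fin (suc m)) → Dec (toℕ (perm D ⟨$⟩ˡ j) ≤ toℕ j)
    backward? j = toℕ (perm D ⟨$⟩ˡ j) ≤? toℕ j

  ∁I₀⊆backward : ∁ (Iset D 0) ⊆ tabulate (does ∘ backward?)
  ∁I₀⊆backward {j} j∈∁I₀ = ∈-tabulate-does⁺ backward? (≮⇒≥ λ j<π⁻¹j →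
    x∈∁p⇒x∉p {p = Iset D 0} j∈∁I₀ (∈-tabulate⁺ {f = I₀-indicator}
      (cong (_∨ isNeg {suc m} (col D j)) (dec-true (toℕ j <? toℕ (perm D ⟨$⟩ˡ j)) j<π⁻¹j))))
    where
    I₀-indicator : Fin (suc m) → Bool
    I₀-indicator k = does (toℕ k <? toℕ (perm D ⟨$⟩ˡ k)) ∨ isNeg {suc m} (col D k)

  forward⇒within⊤-zero : ∀ {i} → i ∈ tabulate (does ∘ backward? ∘ π) → i ≢ zero →
    i ∈ arrowsWithin D (⊤ - zero)
  forward⇒within⊤-zero {i} i∈ i≢0 =
    ∈-tabulate-does⁺ (λ j → cwArrow D j ⊆? (⊤ - zero)) λ k∈Cᵢ →
      x∈p∧x≢y⇒x∈p-y {p = ⊤} {y = zero} ∈⊤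
        λ { refl → cwArrow-avoids-before D noColoops 0<i i≤πi k∈Cᵢ }
    where
    0<i : 0 < toℕ i
    0<i = n≢0⇒n>0 (i≢0 ∘ toℕ-injective)
    i≤πi : toℕ i ≤ toℕ (π i)
    i≤πi = subst (λ w → toℕ w ≤ toℕ (π i)) (inverseˡ (perm D))
                 (∈-tabulate-does⁻ (backward? ∘ π) i∈)

  cw-⊤≤cw-⊤-zero+1 : cw D ⊤ ≤ cw D (⊤ - zero) + 1
  cw-⊤≤cw-⊤-zero+1 = begin
    cw D ⊤                              ≡⟨ cw-⊤ D ⟩
    suc m ∸ ∣ Iset D 0 ∣                ≡⟨ sym (∣∁p∣≡n∸∣p∣ (Iset D 0)) ⟩
    ∣ ∁ (Iset D 0) ∣                    ≤⟨ p⊆q⇒∣p∣≤∣q∣ ∁I₀⊆backward ⟩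
    ∣ tabulate (does ∘ backward?) ∣     ≡⟨ ∣tabulate∣-permute (does ∘ backward?) (perm D) ⟩
    ∣ tabulate (does ∘ backward? ∘ π) ∣ ≤⟨ ∣p∣≤∣q∣+1 zero forward⇒within⊤-zero ⟩
    ∣ arrowsWithin D (⊤ - zero) ∣ + 1   ≡⟨ cong (_+ 1) (sym (cw-≢⊤ D (p-x≢⊤ {p = ⊤} {x = zero} ∈⊤))) ⟩
    cw D (⊤ - zero) + 1                 ∎
    where open ≤-Reasoning

lemma4p14 : (n : ℕ) (D : DecoratedPermutation n) → NoColoops D →
    (A : Subset n) → Nonempty A →
    ∃ λ x → x ∈ A × cw D A ≤ cw D (A - x) + 1
lemma4p14 zero    D noColoops A (() , _)
lemma4p14 (suc m) D noColoops A nonempty = case ≡-dec _≟B_ A ⊤ of λ where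
  (yes refl) → zero , ∈⊤ , cw-⊤≤cw-⊤-zero+1 D noColoops
  (no A≢⊤)   → cw-drop-first-arrow D noColoops A≢⊤ nonempty
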